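{- Let $T$ be a tree of order $n$ with diameter $D(T)=4$, and let $l(T)$ be the number of leaves of $T$. If the central vertex of $\mathring{T}$ is a support vertex of $T$, then $\operatorname{Sd}_s(T,T^c)=l(T)$; otherwise $\operatorname{Sd}_s(T,T^c)=l(T)+1$.
   Context: All graphs are finite, simple and undirected; $T^c$ denotes the complement of $T$ on the same vertex set. $\mathring{T}$ is the subtree of $T$ induced by its non-leaf vertices; when $D(T)=4$ it is a star $K_{1,r}$ with $r\ge 2$, and its central vertex is the vertex of degree $r$ in it. A support vertex of $T$ is a vertex adjacent to a leaf of $T$. For a connected graph $H$, a vertex $w$ strongly resolves $u,v$ if $d_H(u,w)=d_H(u,v)+d_H(v,w)$ or $d_H(v,w)=d_H(v,u)+d_H(u,w)$, where $d_H$ is the shortest-path distance; a set $S\subseteq V(H)$ is a strong metric generator for $H$ if every two distinct vertices are strongly resolved by some vertex of $S$. For connected graphs $G_1,\dots,G_k$ on a common vertex set $V$, $\operatorname{Sd}_s(G_1,\dots,G_k)$ is the minimum cardinality of a set $S\subseteq V$ that is a strong metric generator for every $G_i$. -}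

module Defs where

open import Data.Nat using (ℕ; zero; suc; _+_; _∸_; _≤_)
open import Data.Bool using (Bool; true; false; not; _∧_; if_then_else_)
open import Data.Fin using (Fin; _≟_)
open import Data.Fin.Subset using (Subset; _∈_; ∣_∣)
open import Data.List using (List; map; allFin)
open import Data.Nat.ListAction using (sum)
open import Data.Product using (Σ; ∃; ∃-syntax; _×_; _,_)
open import Data.Sum using (_⊎_)
open import Relation.Nullary using (¬_; does)
open import Relation.Binary.PropositionalEquality using (_≡_; _≢_)

record Graph (n : ℕ) : Set where
  field
    adj    : Fin n → Fin n → Bool
    adj-sym    : ∀ u v → adj u v ≡ adj v u
    adj-irrefl : ∀ v → adj v v ≡ false
open Graph public

complement : ∀ {n} → Graph n → Graph n
complement {n} G = record
  { adj = λ u v → not (adj G u v) ∧ not (does (u ≟ v))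
  ; adj-sym = proof-sym
  ; adj-irrefl = proof-irrefl }
  where
  open import Relation.Binary.PropositionalEquality using (refl; cong₂; sym)
  open import Relation.Nullary using (yes; no)
  import Data.Bool.Properties as BP
  eq-sym : ∀ (u v : Fin n) → does (u ≟ v) ≡ does (v ≟ u)
  eq-sym u v with u ≟ v | v ≟ u
  ... | yes _ | yes _ = refl
  ... | no _  | no _  = refl
  ... | yes p | no q  = Data.Empty.⊥-elim (q (sym p)) where import Data.Empty
  ... | no p  | yes q = Data.Empty.⊥-elim (p (sym q)) where import Data.Empty
  proof-sym : ∀ u v → (not (adj G u v) ∧ not (does (u ≟ v))) ≡ (not (adj G v u) ∧ not (does (v ≟ u)))
  proof-sym u v = cong₂ (λ a b → not a ∧ not b) (Graph.adj-sym G u v) (eq-sym u v)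
  proof-irrefl : ∀ v → (not (adj G v v) ∧ not (does (v ≟ v))) ≡ false
  proof-irrefl v with v ≟ v
  ... | yes _ = BP.∧-zeroʳ (not (adj G v v))
  ... | no ¬p = Data.Empty.⊥-elim (¬p refl) where import Data.Empty

removeEdge : ∀ {n} → Graph n → Fin n → Fin n → Graph n
removeEdge {n} G a b = record
  { adj = λ u v → adj G u v ∧ not (isab u v) ∧ not (isab v u)
  ; adj-sym = λ u v → prf u v
  ; adj-irrefl = λ v → cong (λ x → x ∧ not (isab v v) ∧ not (isab v v)) (Graph.adj-irrefl G v) }
  where
  open import Relation.Binary.PropositionalEquality using (refl; cong; cong₂)
  import Data.Bool.Properties as BP
  isab : Fin n → Fin n → Bool
  isab u v = does (u ≟ a) ∧ does (v ≟ b)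
  prf : ∀ u v → (adj G u v ∧ not (isab u v) ∧ not (isab v u)) ≡ (adj G v u ∧ not (isab v u) ∧ not (isab u v))
  prf u v rewrite Graph.adj-sym G u v = cong (adj G v u ∧_) (BP.∧-comm (not (isab u v)) (not (isab v u)))

data Walk {n} (G : Graph n) : Fin n → Fin n → ℕ → Set where
  here : ∀ {u} → Walk G u u 0
  step : ∀ {u w v k} → adj G u w ≡ true → Walk G w v k → Walk G u v (suc k)

Connected : ∀ {n} → Graph n → Set
Connected G = ∀ u v → ∃[ k ] Walk G u v k

Dist : ∀ {n} → Graph n → Fin n → Fin n → ℕ → Set
Dist G u v k = Walk G u v k × (∀ m → Walk G u v m → k ≤ m)

IsTree : ∀ {n} → Graph n → Set
IsTree G = Connected G × (∀ a b → adj G a b ≡ true → ¬ Connected (removeEdge G a b))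

HasDiameter : ∀ {n} → Graph n → ℕ → Set
HasDiameter G D = (∀ u v k → Dist G u v k → k ≤ D) × (∃[ u ] ∃[ v ] Dist G u v D)

countᵇ : ∀ {n} → (Fin n → Bool) → ℕ
countᵇ {n} p = sum (map (λ w → if p w then 1 else 0) (allFin n))

degree : ∀ {n} → Graph n → Fin n → ℕ
degree G v = countᵇ (adj G v)

isLeafᵇ : ∀ {n} → Graph n → Fin n → Bool
isLeafᵇ G v = does (degree G v Data.Nat.≟ 1)
  where import Data.Nat

IsLeaf : ∀ {n} → Graph n → Fin n → Set
IsLeaf G v = degree G v ≡ 1

numLeaves : ∀ {n} → Graph n → ℕ
numLeaves G = countᵇ (isLeafᵇ G)

IsSupport : ∀ {n} → Graph n → Fin n → Set
IsSupport G v = ∃[ w ] (adj G v w ≡ true × IsLeaf G w)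

-- degree of v inside T̊ (subgraph induced by the non-leaf vertices)
degreeInner : ∀ {n} → Graph n → Fin n → ℕ
degreeInner G v = countᵇ (λ w → adj G v w ∧ not (isLeafᵇ G w))

innerOrder : ∀ {n} → Graph n → ℕ
innerOrder G = countᵇ (λ w → not (isLeafᵇ G w))

-- central vertex of T̊ ≅ K_{1,r}: a vertex of T̊ whose degree in T̊ is
-- r = |V(T̊)| - 1
IsInnerCentral : ∀ {n} → Graph n → Fin n → Set
IsInnerCentral G c = (¬ IsLeaf G c) × (degreeInner G c ≡ innerOrder G ∸ 1)

StronglyResolves : ∀ {n} → Graph n → Fin n → Fin n → Fin n → Set
StronglyResolves H w u v =
  ∃[ a ] ∃[ b ] ∃[ c ]
    (Dist H u w a × Dist H u v b × Dist H v w c ×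
     (a ≡ b + c ⊎ c ≡ b + a))

IsStrongMetricGenerator : ∀ {n} → Graph n → Subset n → Set
IsStrongMetricGenerator {n} H S =
  ∀ (u v : Fin n) → u ≢ v → ∃[ w ] (w ∈ S × StronglyResolves H w u v)

SimStrongDim : ∀ {n} → Graph n → Graph n → ℕ → Set
SimStrongDim {n} G₁ G₂ k =
  (∃[ S ] (IsStrongMetricGenerator G₁ S × IsStrongMetricGenerator G₂ S × ∣ S ∣ ≡ k))
  × (∀ (S : Subset n) → IsStrongMetricGenerator G₁ S → IsStrongMetricGenerator G₂ S → k ≤ ∣ S ∣)

-- In T two leaves are strongly resolved only by themselves, since a leaf is never an interior
-- vertex of a geodesic; in Tᶜ, which has diameter 2, the ends of an edge of T are strongly
-- resolved only by themselves. So a simultaneous strong metric generator S contains all leaves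
-- but at most one, and if it omits a leaf x it contains the neighbour of x: l(T) ≤ |S|. When c
-- is not a support vertex, the edge from c to another vertex of T̊ forces one more non-leaf.
-- Conversely, the leaves together with c, less one leaf adjacent to c if there is one, form a
-- generator: two vertices u, v outside it are neighbours of c with v in T̊, and a leaf y hanging
-- at v has d_T(u,y) = d_T(u,v) + d_T(v,y) and d_Tᶜ(v,y) = d_Tᶜ(v,u) + d_Tᶜ(u,y).
module Submission where

open import Defs
open import Data.Nat using (ℕ; zero; suc; _+_; _∸_; _≤_; _<_; z≤n; s≤s)
import Data.Nat as ℕ
open import Data.Nat.Properties
  using ( ≤-trans; ≤-reflexive; <-≤-trans; ≤-<-trans; <-irrefl; ≮⇒≥; suc-injective; 1+n≢0
        ; +-comm; +-identityʳ; n≤1+n; +-monoʳ-≤; +-mono-≤; anyUpTo?; module ≤-Reasoning)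
open import Data.Nat.Induction using (<-rec)
open import Data.Nat.ListAction using (sum)
open import Data.Bool using (Bool; true; false; not; _∧_; if_then_else_)
import Data.Bool.Properties as Bool
open import Data.Fin using (Fin; zero; suc; _≟_)
open import Data.Fin.Properties using (any?)
open import Data.Fin.Subset using (Subset; inside; outside; _∈_; _∉_; _⊆_; _-_; _∪_; ⁅_⁆; ∣_∣; Nonempty)
open import Data.Fin.Subset.Properties
  using ( _∈?_; p─⊥≡p; p─q⊆p; ∪-identityʳ; nonempty?; Empty-unique; ∣⊥∣≡0; p⊆q⇒∣p∣≤∣q∣; p⊂q⇒∣p∣<∣q∣
        ; x∈p⇒∣p-x∣<∣p∣; x∈p∧x≢y⇒x∈p-y; x∈p∪q⁺; x∈⁅x⁆)
import Data.List as List
import Data.List.Properties as List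
open import Data.Vec using (_∷_; tabulate; here; there)
open import Data.Vec.Properties using (lookup∘tabulate; []=⇒lookup; lookup⇒[]=)
open import Data.Product using (∃-syntax; _×_; _,_; proj₁; proj₂)
open import Data.Sum using (_⊎_; inj₁; inj₂)
open import Data.Empty using (⊥)
open import Function using (_∘_)
open import Relation.Nullary using (¬_; Dec; does; yes; no; ¬?; _×-dec_)
open import Relation.Nullary.Decidable using (dec-true; dec-false)
open import Relation.Nullary.Negation using (contradiction)
open import Relation.Unary using (Decidable)
open import Relation.Binary.PropositionalEquality

-- Counting in subsets of Fin n

dec-true⁻ : ∀ {A : Set} (a? : Dec A) → does a? ≡ true → A
dec-true⁻ (yes a) _ = a

∈-tabulate⁺ : ∀ {n} (f : Fin n → Bool) {x} → f x ≡ true → x ∈ tabulate f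
∈-tabulate⁺ f {x} fx = lookup⇒[]= x (tabulate f) (trans (lookup∘tabulate f x) fx)

∈-tabulate⁻ : ∀ {n} (f : Fin n → Bool) {x} → x ∈ tabulate f → f x ≡ true
∈-tabulate⁻ f {x} x∈ = trans (sym (lookup∘tabulate f x)) ([]=⇒lookup x∈)

countᵇ≡∣tabulate∣ : ∀ {n} (f : Fin n → Bool) → countᵇ f ≡ ∣ tabulate f ∣
countᵇ≡∣tabulate∣ {n} f = trans (cong sum (List.map-tabulate {n = n} (λ x → x) (λ w → if f w then 1 else 0))) (go f)
  where
  go : ∀ {m} (g : Fin m → Bool) → sum (List.tabulate (λ x → if g x then 1 else 0)) ≡ ∣ tabulate g ∣
  go {zero} g = refl
  go {suc m} g with g zero
  ... | true  = cong suc (go (λ x → g (suc x)))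
  ... | false = go (λ x → g (suc x))

∣p∣≡1+∣p-x∣ : ∀ {n} {p : Subset n} {x} → x ∈ p → ∣ p ∣ ≡ suc ∣ p - x ∣
∣p∣≡1+∣p-x∣ {p = inside ∷ p} here = cong suc (cong ∣_∣ (sym (p─⊥≡p p)))
∣p∣≡1+∣p-x∣ {p = inside ∷ p} (there x∈p) = cong suc (∣p∣≡1+∣p-x∣ x∈p)
∣p∣≡1+∣p-x∣ {p = outside ∷ p} (there x∈p) = ∣p∣≡1+∣p-x∣ x∈p

∣p∪⁅x⁆∣≡1+∣p∣ : ∀ {n} {p : Subset n} {x} → x ∉ p → ∣ p ∪ ⁅ x ⁆ ∣ ≡ suc ∣ p ∣
∣p∪⁅x⁆∣≡1+∣p∣ {p = inside ∷ p} {zero} x∉p = contradiction here x∉p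
∣p∪⁅x⁆∣≡1+∣p∣ {p = outside ∷ p} {zero} x∉p = cong suc (cong ∣_∣ (∪-identityʳ {n = _} p))
∣p∪⁅x⁆∣≡1+∣p∣ {p = inside ∷ p} {suc x} x∉p = cong suc (∣p∪⁅x⁆∣≡1+∣p∣ (λ x∈p → x∉p (there x∈p)))
∣p∪⁅x⁆∣≡1+∣p∣ {p = outside ∷ p} {suc x} x∉p = ∣p∪⁅x⁆∣≡1+∣p∣ (λ x∈p → x∉p (there x∈p))

x∈p-y⇒x∈p : ∀ {n} {p : Subset n} {x y} → x ∈ p - y → x ∈ p
x∈p-y⇒x∈p {p = p} {y = y} = p─q⊆p p ⁅ y ⁆

x∈p-y⇒x≢y : ∀ {n} {p : Subset n} {x y} → x ∈ p - y → x ≢ y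
x∈p-y⇒x≢y {p = _ ∷ p} {zero} {zero} ()
x∈p-y⇒x≢y {p = _ ∷ p} {zero} {suc y} _ ()
x∈p-y⇒x≢y {p = _ ∷ p} {suc x} {zero} _ ()
x∈p-y⇒x≢y {p = _ ∷ p} {suc x} {suc y} (there x∈) refl = x∈p-y⇒x≢y x∈ refl

∣p∣≢0⇒nonempty : ∀ {n} (p : Subset n) → ∣ p ∣ ≢ 0 → Nonempty p
∣p∣≢0⇒nonempty {n} p ∣p∣≢0 with nonempty? p
... | yes ne = ne
... | no empty = contradiction (trans (cong ∣_∣ (Empty-unique empty)) (∣⊥∣≡0 n)) ∣p∣≢0

0<∣p∣ : ∀ {n} {p : Subset n} {x} → x ∈ p → 0 < ∣ p ∣
0<∣p∣ x∈p = ≤-trans (s≤s z≤n) (x∈p⇒∣p-x∣<∣p∣ x∈p)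

∣p∣≡1⇒unique : ∀ {n} {p : Subset n} → ∣ p ∣ ≡ 1 → ∀ {x y} → x ∈ p → y ∈ p → x ≡ y
∣p∣≡1⇒unique ∣p∣≡1 {x} {y} x∈p y∈p with y ≟ x
... | yes y≡x = sym y≡x
... | no y≢x = contradiction (0<∣p∣ (x∈p∧x≢y⇒x∈p-y y∈p y≢x)) λ 0<∣p-x∣ →
  <-irrefl (sym (suc-injective (trans (sym (∣p∣≡1+∣p-x∣ x∈p)) ∣p∣≡1))) 0<∣p-x∣

∣p∣≢1⇒another : ∀ {n} {p : Subset n} → ∣ p ∣ ≢ 1 → ∀ {x} → x ∈ p → ∃[ y ] (y ∈ p × y ≢ x)
∣p∣≢1⇒another {p = p} ∣p∣≢1 {x} x∈p
  with ∣p∣≢0⇒nonempty (p - x) (λ ∣p-x∣≡0 → ∣p∣≢1 (trans (∣p∣≡1+∣p-x∣ x∈p) (cong suc ∣p-x∣≡0)))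
... | y , y∈p-x = y , x∈p-y⇒x∈p y∈p-x , x∈p-y⇒x≢y y∈p-x

p⊆q∧∣q∣≤∣p∣⇒q⊆p : ∀ {n} {p q : Subset n} → p ⊆ q → ∣ q ∣ ≤ ∣ p ∣ → q ⊆ p
p⊆q∧∣q∣≤∣p∣⇒q⊆p {p = p} p⊆q ∣q∣≤∣p∣ {x} x∈q with x ∈? p
... | yes x∈p = x∈p
... | no x∉p = contradiction (p⊂q⇒∣p∣<∣q∣ (p⊆q , x , x∈q , x∉p)) (λ lt → <-irrefl refl (<-≤-trans lt ∣q∣≤∣p∣))

⊆-or-counterexample : ∀ {n} (p q : Subset n) → p ⊆ q ⊎ ∃[ x ] (x ∈ p × x ∉ q)
⊆-or-counterexample p q with any? (λ x → (x ∈? p) ×-dec ¬? (x ∈? q))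
... | yes escapee = inj₂ escapee
... | no none = inj₁ λ {x} x∈p → inside-q x∈p
  where
  inside-q : ∀ {x} → x ∈ p → x ∈ q
  inside-q {x} x∈p with x ∈? q
  ... | yes x∈q = x∈q
  ... | no x∉q = contradiction (x , x∈p , x∉q) none

p-x⊆q-y⇒∣p∣≤∣q∣ : ∀ {n} {p q : Subset n} {x y} → x ∈ p → y ∈ q → p - x ⊆ q - y → ∣ p ∣ ≤ ∣ q ∣
p-x⊆q-y⇒∣p∣≤∣q∣ {p = p} {q} {x} {y} x∈p y∈q ⊆ = begin
  ∣ p ∣          ≡⟨ ∣p∣≡1+∣p-x∣ x∈p ⟩
  suc ∣ p - x ∣  ≤⟨ s≤s (p⊆q⇒∣p∣≤∣q∣ ⊆) ⟩
  suc ∣ q - y ∣  ≡⟨ sym (∣p∣≡1+∣p-x∣ y∈q) ⟩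
  ∣ q ∣          ∎
  where open ≤-Reasoning

-- Walks, distances and strong resolution

least-witness : {P : ℕ → Set} → Decidable P → ∀ {k} → P k → ∃[ m ] (P m × ∀ j → P j → m ≤ j)
least-witness {P} P? {k} = <-rec (λ k → P k → ∃[ m ] (P m × ∀ j → P j → m ≤ j)) search k
  where
  search : ∀ k → (∀ {j} → j < k → P j → ∃[ m ] (P m × ∀ j → P j → m ≤ j)) →
    P k → ∃[ m ] (P m × ∀ j → P j → m ≤ j)
  search k smaller Pk with anyUpTo? P? k
  ... | yes (j , j<k , Pj) = smaller j<k Pj
  ... | no none = k , Pk , λ j Pj → ≮⇒≥ (λ j<k → none (j , j<k , Pj))

3≰2 : ¬ (3 ≤ 2)
3≰2 (s≤s (s≤s ()))

module _ {n : ℕ} (G : Graph n) where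

  adj⇒≢ : ∀ {u v} → adj G u v ≡ true → u ≢ v
  adj⇒≢ {u} uv refl with () ← trans (sym uv) (adj-irrefl G u)

  adj-sym′ : ∀ {u v} → adj G u v ≡ true → adj G v u ≡ true
  adj-sym′ {u} {v} uv = trans (adj-sym G v u) uv

  snocʷ : ∀ {u v w k} → Walk G u v k → adj G v w ≡ true → Walk G u w (suc k)
  snocʷ here vw = step vw here
  snocʷ (step e p) vw = step e (snocʷ p vw)

  reverseʷ : ∀ {u v k} → Walk G u v k → Walk G v u k
  reverseʷ here = here
  reverseʷ (step e p) = snocʷ (reverseʷ p) (adj-sym′ e)

  _++ʷ_ : ∀ {u v w a b} → Walk G u v a → Walk G v w b → Walk G u w (a + b)
  here ++ʷ q = q
  step e p ++ʷ q = step e (p ++ʷ q)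

  walk₀⇒≡ : ∀ {u v} → Walk G u v 0 → u ≡ v
  walk₀⇒≡ here = refl

  walk₁⇒adj : ∀ {u v} → Walk G u v 1 → adj G u v ≡ true
  walk₁⇒adj (step e here) = e

  walk₂⇒common : ∀ {u v} → Walk G u v 2 → ∃[ m ] (adj G u m ≡ true × adj G m v ≡ true)
  walk₂⇒common (step e (step e′ here)) = _ , e , e′

  walk? : ∀ k u v → Dec (Walk G u v k)
  walk? zero u v with u ≟ v
  ... | yes refl = yes here
  ... | no u≢v = no λ p → u≢v (walk₀⇒≡ p)
  walk? (suc k) u v with any? (λ w → (adj G u w Bool.≟ true) ×-dec walk? k w v)
  ... | yes (w , e , p) = yes (step e p)
  ... | no none = no λ { (step e p) → none (_ , e , p) }

  walk⇒dist : ∀ {u v k} → Walk G u v k → ∃[ m ] Dist G u v m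
  walk⇒dist {u} {v} = least-witness (λ k → walk? k u v)

  connected⇒dist : Connected G → ∀ u v → ∃[ d ] Dist G u v d
  connected⇒dist connected u v = walk⇒dist (proj₂ (connected u v))

  dist-sym : ∀ {u v k} → Dist G u v k → Dist G v u k
  dist-sym (p , minimal) = reverseʷ p , λ j q → minimal j (reverseʷ q)

  dist-intro : ∀ {u v k} → Walk G u v k → (∀ j → j < k → ¬ Walk G u v j) → Dist G u v k
  dist-intro p shorter = p , λ j q → ≮⇒≥ (λ j<k → shorter j j<k q)

  dist₀ : ∀ u → Dist G u u 0
  dist₀ u = here , λ _ _ → z≤n

  dist₁ : ∀ {u v} → adj G u v ≡ true → Dist G u v 1
  dist₁ uv = dist-intro (step uv here) λ { zero _ p → adj⇒≢ uv (walk₀⇒≡ p) ; (suc _) (s≤s ()) }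

  dist₂ : ∀ {u v w} → u ≢ v → adj G u v ≡ false → adj G u w ≡ true → adj G w v ≡ true → Dist G u v 2
  dist₂ u≢v ¬uv uw wv = dist-intro (step uw (step wv here)) λ
    { zero _ p → u≢v (walk₀⇒≡ p)
    ; (suc zero) _ p → Bool.not-¬ (walk₁⇒adj p) ¬uv
    ; (suc (suc _)) (s≤s (s≤s ())) }

  dist₃ : ∀ {u v} → u ≢ v → adj G u v ≡ false → (∀ {m} → adj G u m ≡ true → adj G m v ≡ true → ⊥) →
    Walk G u v 3 → Dist G u v 3
  dist₃ u≢v ¬uv no-common p = dist-intro p λ
    { zero _ q → u≢v (walk₀⇒≡ q)
    ; (suc zero) _ q → Bool.not-¬ (walk₁⇒adj q) ¬uv
    ; (suc (suc zero)) _ q → let _ , um , mv = walk₂⇒common q in no-common um mv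
    ; (suc (suc (suc _))) (s≤s (s≤s (s≤s ()))) }

  StronglyResolves-sym : ∀ {w u v} → StronglyResolves G w u v → StronglyResolves G w v u
  StronglyResolves-sym (a , b , c , duw , duv , dvw , inj₁ a≡b+c) =
    c , b , a , dvw , dist-sym duv , duw , inj₂ a≡b+c
  StronglyResolves-sym (a , b , c , duw , duv , dvw , inj₂ c≡b+a) =
    c , b , a , dvw , dist-sym duv , duw , inj₁ c≡b+a

  resolves-endpoint : ∀ {u v d} → Dist G u v d → StronglyResolves G u u v
  resolves-endpoint {u} {d = d} duv = 0 , d , d , dist₀ u , duv , dist-sym duv , inj₂ (sym (+-identityʳ d))

  generator-separates : ∀ {S : Subset n} {u v} → IsStrongMetricGenerator G S → u ≢ v →
    (∀ {w} → w ≢ u → w ≢ v → ¬ StronglyResolves G w u v) → u ∈ S ⊎ v ∈ S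
  generator-separates {u = u} {v} gen u≢v unresolved with gen u v u≢v
  ... | w , w∈S , res with w ≟ u | w ≟ v
  ... | yes refl | _ = inj₁ w∈S
  ... | no _ | yes refl = inj₂ w∈S
  ... | no w≢u | no w≢v = contradiction res (unresolved w≢u w≢v)

  Pendant : Fin n → Set
  Pendant v = ∀ {a b} → adj G v a ≡ true → adj G v b ≡ true → a ≡ b

  pendant-shortcut : ∀ {x v w b c} → Pendant v → Walk G x v (suc b) → Walk G v w (suc c) → Walk G x w (b + c)
  pendant-shortcut pendant p (step e₂ q) with reverseʷ p
  ... | step e₁ p′ with refl ← pendant e₁ e₂ = reverseʷ p′ ++ʷ q

  pendant-not-between : ∀ {x v w a b c} → Pendant v → x ≢ v → w ≢ v →
    Dist G x w a → Dist G x v b → Dist G v w c → a ≢ b + c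
  pendant-not-between {b = zero} _ x≢v _ _ (p , _) _ _ = x≢v (walk₀⇒≡ p)
  pendant-not-between {b = suc b} {zero} _ _ w≢v _ _ (q , _) _ = w≢v (sym (walk₀⇒≡ q))
  pendant-not-between {b = suc b} {suc c} pendant _ _ (_ , minimal) (p , _) (q , _) refl =
    <-irrefl refl (≤-trans (+-monoʳ-≤ (suc b) (n≤1+n c)) (minimal _ (pendant-shortcut pendant p q)))

  pendants-unresolved : ∀ {u v w} → Pendant u → Pendant v → u ≢ v → w ≢ u → w ≢ v → ¬ StronglyResolves G w u v
  pendants-unresolved _ pv u≢v w≢u w≢v (_ , _ , _ , duw , duv , dvw , inj₁ a≡b+c) =
    pendant-not-between pv u≢v w≢v duw duv dvw a≡b+c
  pendants-unresolved pu _ u≢v w≢u w≢v (_ , _ , _ , duw , duv , dvw , inj₂ c≡b+a) =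
    pendant-not-between pu (λ v≡u → u≢v (sym v≡u)) w≢u dvw (dist-sym duv) duw c≡b+a

  dist-≢⇒≥1 : ∀ {u v d} → u ≢ v → Dist G u v d → 1 ≤ d
  dist-≢⇒≥1 {d = zero} u≢v (p , _) = contradiction (walk₀⇒≡ p) u≢v
  dist-≢⇒≥1 {d = suc _} _ _ = s≤s z≤n

  dist-nonadjacent⇒≥2 : ∀ {u v d} → u ≢ v → adj G u v ≡ false → Dist G u v d → 2 ≤ d
  dist-nonadjacent⇒≥2 {d = zero} u≢v _ (p , _) = contradiction (walk₀⇒≡ p) u≢v
  dist-nonadjacent⇒≥2 {d = suc zero} _ ¬uv (p , _) = contradiction (walk₁⇒adj p) (Bool.not-¬ ¬uv)
  dist-nonadjacent⇒≥2 {d = suc (suc _)} _ _ _ = s≤s (s≤s z≤n)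

  module _ (near : ∀ {u v} → u ≢ v → ∃[ k ] (k ≤ 2 × Walk G u v k)) where

    dist≤2 : ∀ {u v d} → u ≢ v → Dist G u v d → d ≤ 2
    dist≤2 u≢v (_ , minimal) = let _ , k≤2 , p = near u≢v in ≤-trans (minimal _ p) k≤2

    nonadjacent-unresolved : ∀ {u v w} → u ≢ v → adj G u v ≡ false → w ≢ u → w ≢ v → ¬ StronglyResolves G w u v
    nonadjacent-unresolved u≢v ¬uv w≢u w≢v (_ , _ , _ , duw , duv , dvw , inj₁ refl) =
      3≰2 (≤-trans (+-mono-≤ (dist-nonadjacent⇒≥2 u≢v ¬uv duv) (dist-≢⇒≥1 (λ v≡w → w≢v (sym v≡w)) dvw))
                   (dist≤2 (λ u≡w → w≢u (sym u≡w)) duw))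
    nonadjacent-unresolved u≢v ¬uv w≢u w≢v (_ , _ , _ , duw , duv , dvw , inj₂ refl) =
      3≰2 (≤-trans (+-mono-≤ (dist-nonadjacent⇒≥2 u≢v ¬uv duv) (dist-≢⇒≥1 (λ u≡w → w≢u (sym u≡w)) duw))
                   (dist≤2 (λ v≡w → w≢v (sym v≡w)) dvw))

-- Leaves, complements and trees

module _ {n : ℕ} (G : Graph n) where

  neighbours : Fin n → Subset n
  neighbours v = tabulate (adj G v)

  degree≡∣neighbours∣ : ∀ v → degree G v ≡ ∣ neighbours v ∣
  degree≡∣neighbours∣ v = countᵇ≡∣tabulate∣ (adj G v)

  leaves : Subset n
  leaves = tabulate (isLeafᵇ G)

  numLeaves≡∣leaves∣ : numLeaves G ≡ ∣ leaves ∣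
  numLeaves≡∣leaves∣ = countᵇ≡∣tabulate∣ (isLeafᵇ G)

  isLeaf? : ∀ v → Dec (IsLeaf G v)
  isLeaf? v = degree G v ℕ.≟ 1

  ∈leaves⁺ : ∀ {v} → IsLeaf G v → v ∈ leaves
  ∈leaves⁺ {v} leaf = ∈-tabulate⁺ (isLeafᵇ G) (dec-true (isLeaf? v) leaf)

  ∈leaves⁻ : ∀ {v} → v ∈ leaves → IsLeaf G v
  ∈leaves⁻ {v} v∈leaves = dec-true⁻ (isLeaf? v) (∈-tabulate⁻ (isLeafᵇ G) v∈leaves)

  leaf-pendant : ∀ {v} → IsLeaf G v → Pendant G v
  leaf-pendant {v} leaf va vb =
    ∣p∣≡1⇒unique (trans (sym (degree≡∣neighbours∣ v)) leaf) (∈-tabulate⁺ (adj G v) va) (∈-tabulate⁺ (adj G v) vb)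

  non-leaf-another-neighbour : ∀ {v a} → ¬ IsLeaf G v → adj G v a ≡ true → ∃[ b ] (adj G v b ≡ true × b ≢ a)
  non-leaf-another-neighbour {v} ¬leaf va
    with ∣p∣≢1⇒another (λ ∣N∣≡1 → ¬leaf (trans (degree≡∣neighbours∣ v) ∣N∣≡1)) (∈-tabulate⁺ (adj G v) va)
  ... | b , b∈N , b≢a = b , ∈-tabulate⁻ (adj G v) b∈N , b≢a

  leaf-neighbour : ∀ {v} → IsLeaf G v → ∃[ a ] (adj G v a ≡ true)
  leaf-neighbour {v} leaf
    with ∣p∣≢0⇒nonempty (neighbours v) (λ ∣N∣≡0 → 1+n≢0 (trans (sym leaf) (trans (degree≡∣neighbours∣ v) ∣N∣≡0)))
  ... | a , a∈N = a , ∈-tabulate⁻ (adj G v) a∈N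

  complement-adj⁺ : ∀ {u v} → adj G u v ≡ false → u ≢ v → adj (complement G) u v ≡ true
  complement-adj⁺ {u} {v} ¬uv u≢v = cong₂ (λ x y → not x ∧ not y) ¬uv (dec-false (u ≟ v) u≢v)

  complement-nonadj : ∀ {u v} → adj G u v ≡ true → adj (complement G) u v ≡ false
  complement-nonadj {u} {v} uv = cong (λ x → not x ∧ not (does (u ≟ v))) uv

  two-neighbours⇒non-leaf : ∀ {v a b} → adj G v a ≡ true → adj G v b ≡ true → a ≢ b → ¬ IsLeaf G v
  two-neighbours⇒non-leaf va vb a≢b leaf = a≢b (leaf-pendant leaf va vb)

  adjacent-leaves-closed : ∀ {x y} → IsLeaf G x → IsLeaf G y → adj G x y ≡ true →
    ∀ {u v k} → Walk G u v k → u ≡ x ⊎ u ≡ y → v ≡ x ⊎ v ≡ y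
  adjacent-leaves-closed _ _ _ here u∈xy = u∈xy
  adjacent-leaves-closed lx ly xy (step e p) (inj₁ refl) =
    adjacent-leaves-closed lx ly xy p (inj₂ (leaf-pendant lx e xy))
  adjacent-leaves-closed lx ly xy (step e p) (inj₂ refl) =
    adjacent-leaves-closed lx ly xy p (inj₁ (leaf-pendant ly e (adj-sym′ G xy)))

-- Deleting the edge ab loses no connection when a and b have a common neighbour z.
module Detour {n : ℕ} (G : Graph n) {a b z : Fin n} (az : adj G a z ≡ true) (zb : adj G z b ≡ true) where

  not-both : ∀ {u w} → ¬ (u ≡ a × w ≡ b) → not (does (u ≟ a) ∧ does (w ≟ b)) ≡ true
  not-both {u} {w} h with u ≟ a | w ≟ b
  ... | yes u≡a | yes w≡b = contradiction (u≡a , w≡b) h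
  ... | yes _ | no _ = refl
  ... | no _ | _ = refl

  kept : ∀ {u w} → adj G u w ≡ true → ¬ (u ≡ a × w ≡ b) → ¬ (w ≡ a × u ≡ b) → adj (removeEdge G a b) u w ≡ true
  kept uw h₁ h₂ = cong₂ _∧_ uw (cong₂ _∧_ (not-both h₁) (not-both h₂))

  z≢a : z ≢ a
  z≢a z≡a = adj⇒≢ G az (sym z≡a)

  z≢b : z ≢ b
  z≢b = adj⇒≢ G zb

  reroute : ∀ {u v k} → Walk G u v k → ∃[ m ] Walk (removeEdge G a b) u v m
  reroute here = 0 , here
  reroute (step {u} {w} e p) with reroute p | (u ≟ a) ×-dec (w ≟ b) | (w ≟ a) ×-dec (u ≟ b)
  ... | _ , q | yes (refl , refl) | _ =
    _ , step (kept az (z≢b ∘ proj₂) (z≢a ∘ proj₁)) (step (kept zb (z≢a ∘ proj₁) (z≢b ∘ proj₂)) q)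
  ... | _ , q | no _ | yes (refl , refl) =
    _ , step (kept (adj-sym′ G zb) (z≢b ∘ proj₂) (z≢a ∘ proj₁))
          (step (kept (adj-sym′ G az) (z≢a ∘ proj₁) (z≢b ∘ proj₂)) q)
  ... | _ , q | no h₁ | no h₂ = _ , step (kept e h₁ h₂) q

tree-triangle-free : ∀ {n} {G : Graph n} → IsTree G → ∀ {a b z} →
  adj G a b ≡ true → adj G b z ≡ true → adj G z a ≡ true → ⊥
tree-triangle-free {G = G} (connected , bridges) ab bz za =
  bridges _ _ ab (λ u v → Detour.reroute G (adj-sym′ G za) (adj-sym′ G bz) (proj₂ (connected u v)))

-- Trees of diameter four

module DiameterFour {n : ℕ} (T : Graph n) (tree : IsTree T) (diameter : HasDiameter T 4)
  (c : Fin n) (central : IsInnerCentral T c) where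

  Tᶜ : Graph n
  Tᶜ = complement T

  infix 4 _~_
  _~_ : Fin n → Fin n → Set
  u ~ v = adj T u v ≡ true

  ~-sym : ∀ {u v} → u ~ v → v ~ u
  ~-sym = adj-sym′ T

  non-edge : ∀ {u v} → ¬ u ~ v → adj T u v ≡ false
  non-edge = Bool.¬-not

  triangle-free : ∀ {a b z} → a ~ b → b ~ z → z ~ a → ⊥
  triangle-free = tree-triangle-free tree

  c-non-leaf : ¬ IsLeaf T c
  c-non-leaf = proj₁ central

  -- The vertices of T̊ other than its centre, i.e. the leaves of the star T̊.
  Arm : Fin n → Set
  Arm s = ¬ IsLeaf T s × s ≢ c

  -- IsInnerCentral makes the non-leaf neighbours of c as many as the vertices of T̊ other than c,
  -- and the former are among the latter.
  arm-adjacent-centre : ∀ {s} → Arm s → c ~ s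
  arm-adjacent-centre {s} (s-non-leaf , s≢c) =
    proj₁ (∧-true⁻ (∈-tabulate⁻ centre-arms
      (p⊆q∧∣q∣≤∣p∣⇒q⊆p centre-arms⊆ ∣inner-c∣≤ (x∈p∧x≢y⇒x∈p-y (∈inner s-non-leaf) s≢c))))
    where
    ∧-true⁻ : ∀ {x y} → x ∧ y ≡ true → x ≡ true × y ≡ true
    ∧-true⁻ {true} {true} refl = refl , refl
    inner centre-arms : Fin n → Bool
    inner w = not (isLeafᵇ T w)
    centre-arms w = adj T c w ∧ not (isLeafᵇ T w)
    ∈inner : ∀ {w} → ¬ IsLeaf T w → w ∈ tabulate inner
    ∈inner {w} ¬leaf = ∈-tabulate⁺ inner (cong not (dec-false (isLeaf? T w) ¬leaf))
    centre-arms⊆ : tabulate centre-arms ⊆ tabulate inner - c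
    centre-arms⊆ {w} w∈ = let cw , inner-w = ∧-true⁻ (∈-tabulate⁻ centre-arms w∈) in
      x∈p∧x≢y⇒x∈p-y (∈-tabulate⁺ inner inner-w) (λ w≡c → adj⇒≢ T cw (sym w≡c))
    ∣inner-c∣≤ : ∣ tabulate inner - c ∣ ≤ ∣ tabulate centre-arms ∣
    ∣inner-c∣≤ = ≤-reflexive (begin
      ∣ tabulate inner - c ∣       ≡⟨ cong (_∸ 1) (sym (∣p∣≡1+∣p-x∣ (∈inner c-non-leaf))) ⟩
      ∣ tabulate inner ∣ ∸ 1       ≡⟨ cong (_∸ 1) (sym (countᵇ≡∣tabulate∣ inner)) ⟩
      innerOrder T ∸ 1             ≡⟨ sym (proj₂ central) ⟩
      degreeInner T c              ≡⟨ countᵇ≡∣tabulate∣ centre-arms ⟩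
      ∣ tabulate centre-arms ∣     ∎)
      where open ≡-Reasoning

  non-leaf-adjacent-centre : ∀ {u} → ¬ IsLeaf T u → u ≢ c → u ~ c
  non-leaf-adjacent-centre u-non-leaf u≢c = ~-sym (arm-adjacent-centre (u-non-leaf , u≢c))

  arms-nonadjacent : ∀ {s t} → Arm s → Arm t → ¬ s ~ t
  arms-nonadjacent as at st = triangle-free (arm-adjacent-centre as) st (~-sym (arm-adjacent-centre at))

  two-arms : ∃[ s ] ∃[ t ] (Arm s × Arm t × s ≢ t)
  two-arms with proj₂ diameter
  ... | v₀ , v₄ , step {w = v₁} e₁ (step {w = v₂} e₂ (step {w = v₃} e₃ (step e₄ here))) , minimal =
    pick (two-neighbours⇒non-leaf T (~-sym e₁) e₂ v₀≢v₂) (two-neighbours⇒non-leaf T (~-sym e₂) e₃ v₁≢v₃)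
         (two-neighbours⇒non-leaf T (~-sym e₃) e₄ v₂≢v₄) (adj⇒≢ T e₂) (adj⇒≢ T e₃) v₁≢v₃
    where
    4≰2 : ¬ (4 ≤ 2)
    4≰2 (s≤s (s≤s ()))
    v₀≢v₂ : v₀ ≢ v₂
    v₀≢v₂ refl = 4≰2 (minimal 2 (step e₃ (step e₄ here)))
    v₂≢v₄ : v₂ ≢ v₄
    v₂≢v₄ refl = 4≰2 (minimal 2 (step e₁ (step e₂ here)))
    v₁≢v₃ : v₁ ≢ v₃
    v₁≢v₃ refl = 4≰2 (minimal 2 (step e₁ (step e₄ here)))
    pick : ∀ {a b d} → ¬ IsLeaf T a → ¬ IsLeaf T b → ¬ IsLeaf T d → a ≢ b → b ≢ d → a ≢ d →
      ∃[ s ] ∃[ t ] (Arm s × Arm t × s ≢ t)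
    pick {a} {b} {d} la lb ld a≢b b≢d a≢d with a ≟ c | d ≟ c
    ... | yes refl | _ = b , d , (lb , a≢b ∘ sym) , (ld , a≢d ∘ sym) , b≢d
    ... | no a≢c | yes refl = a , b , (la , a≢c) , (lb , b≢d) , a≢b
    ... | no a≢c | no d≢c = a , d , (la , a≢c) , (ld , d≢c) , a≢d

  arm-other-than : ∀ p → ∃[ s ] (Arm s × s ≢ p)
  arm-other-than p with two-arms
  ... | s , t , as , at , s≢t with s ≟ p
  ... | no s≢p = s , as , s≢p
  ... | yes refl = t , at , s≢t ∘ sym

  arm-avoiding : ∀ {u w} → u ~ w → ∃[ s ] (Arm s × s ≢ u × s ≢ w)
  arm-avoiding {u} {w} uw with two-arms
  ... | s , t , as , at , s≢t with s ≟ u | s ≟ w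
  ... | no s≢u | no s≢w = s , as , s≢u , s≢w
  ... | yes refl | _ = t , at , s≢t ∘ sym , λ { refl → arms-nonadjacent as at uw }
  ... | no _ | yes refl = t , at , (λ { refl → arms-nonadjacent at as uw }) , s≢t ∘ sym

  arm-leaf : ∀ {s} → Arm s → ∃[ y ] (s ~ y × IsLeaf T y)
  arm-leaf {s} as@(s-non-leaf , _) with non-leaf-another-neighbour T s-non-leaf (~-sym (arm-adjacent-centre as))
  ... | y , sy , y≢c with isLeaf? T y
  ... | yes y-leaf = y , sy , y-leaf
  ... | no y-non-leaf = contradiction sy (arms-nonadjacent as (y-non-leaf , y≢c))

  leaf-neighbour-non-leaf : ∀ {x p} → IsLeaf T x → x ~ p → ¬ IsLeaf T p
  leaf-neighbour-non-leaf {x} x-leaf xp p-leaf with two-arms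
  ... | s , _ , (s-non-leaf , _) , _
    with adjacent-leaves-closed T x-leaf p-leaf xp (proj₂ (proj₁ tree x s)) (inj₁ refl)
  ... | inj₁ refl = s-non-leaf x-leaf
  ... | inj₂ refl = s-non-leaf p-leaf

  complement-common-neighbour : ∀ {u w} → u ~ w → ∃[ y ] (adj Tᶜ u y ≡ true × adj Tᶜ y w ≡ true)
  complement-common-neighbour {u} {w} uw with arm-avoiding uw
  ... | s , as , s≢u , s≢w with arm-leaf as
  ... | y , sy , y-leaf =
    y , complement-adj⁺ T (non-edge (away s≢u)) (λ { refl → away s≢w (~-sym uw) })
      , complement-adj⁺ T (non-edge (away s≢w ∘ ~-sym)) (λ { refl → away s≢u uw })
    where
    away : ∀ {v} → s ≢ v → ¬ v ~ y
    away s≢v vy = s≢v (leaf-pendant T y-leaf (~-sym sy) (~-sym vy))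

  complement-near : ∀ {u w} → u ≢ w → ∃[ k ] (k ≤ 2 × Walk Tᶜ u w k)
  complement-near {u} {w} u≢w with adj T u w in e
  ... | false = 1 , s≤s z≤n , step (complement-adj⁺ T e u≢w) here
  ... | true = let _ , uy , yw = complement-common-neighbour e in 2 , s≤s (s≤s z≤n) , step uy (step yw here)

  complement-connected : Connected Tᶜ
  complement-connected u w with u ≟ w
  ... | yes refl = 0 , here
  ... | no u≢w = let k , _ , p = complement-near u≢w in k , p

  arm-leaf-resolves : ∀ {u v} → u ≢ v → Arm v → u ~ c →
    ∃[ y ] (v ~ y × IsLeaf T y × StronglyResolves T y u v × StronglyResolves Tᶜ y u v)
  arm-leaf-resolves {u} {v} u≢v av uc with arm-leaf av
  ... | y , vy , y-leaf =
    y , vy , y-leaf , (3 , 2 , 1 , d-uy , d-uv , dist₁ T vy , inj₁ refl)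
                    , (1 , 1 , 2 , dist₁ Tᶜ cuy , dist₁ Tᶜ cuv , dᶜ-vy , inj₂ refl)
    where
    cv : c ~ v
    cv = arm-adjacent-centre av
    ¬uv : ¬ u ~ v
    ¬uv uv = triangle-free uv (~-sym cv) (~-sym uc)
    only-v : ∀ {x} → x ~ y → x ≡ v
    only-v xy = leaf-pendant T y-leaf (~-sym xy) (~-sym vy)
    u≢y : u ≢ y
    u≢y refl = proj₂ av (sym (only-v (~-sym uc)))
    ¬uy : ¬ u ~ y
    ¬uy uy = u≢v (only-v uy)
    d-uy : Dist T u y 3
    d-uy = dist₃ T u≢y (non-edge ¬uy) (λ um my → ¬uv (subst (u ~_) (only-v my) um))
                 (step uc (step cv (step vy here)))
    d-uv : Dist T u v 2
    d-uv = dist₂ T u≢v (non-edge ¬uv) uc cv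
    cuy : adj Tᶜ u y ≡ true
    cuy = complement-adj⁺ T (non-edge ¬uy) u≢y
    cuv : adj Tᶜ u v ≡ true
    cuv = complement-adj⁺ T (non-edge ¬uv) u≢v
    dᶜ-vy : Dist Tᶜ v y 2
    dᶜ-vy = dist₂ Tᶜ (adj⇒≢ T vy) (complement-nonadj T vy) (adj-sym′ Tᶜ cuv) cuy

  module _ {S : Subset n}
    (outside-adjacent-centre : ∀ {u} → u ∉ S → u ~ c)
    (one-leaf-outside : ∀ {u v} → u ∉ S → v ∉ S → IsLeaf T u → IsLeaf T v → u ≡ v)
    (arm-leaves-inside : ∀ {v y} → Arm v → v ~ y → IsLeaf T y → y ∈ S) where

    outside-arm : ∀ {u} → u ∉ S → ¬ IsLeaf T u → Arm u
    outside-arm u∉S u-non-leaf = u-non-leaf , adj⇒≢ T (outside-adjacent-centre u∉S)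

    resolving : (H : Graph n) → Connected H →
      (∀ {u v} → u ≢ v → Arm v → u ~ c → ∃[ y ] (v ~ y × IsLeaf T y × StronglyResolves H y u v)) →
      IsStrongMetricGenerator H S
    resolving H connected resolved-by-arm-leaf u v u≢v with u ∈? S | v ∈? S
    ... | yes u∈S | _ = u , u∈S , resolves-endpoint H (proj₂ (connected⇒dist H connected u v))
    ... | no _ | yes v∈S = v , v∈S , StronglyResolves-sym H (resolves-endpoint H (proj₂ (connected⇒dist H connected v u)))
    ... | no u∉S | no v∉S with isLeaf? T u | isLeaf? T v
    ... | _ | no v-non-leaf =
      let av = outside-arm v∉S v-non-leaf
          y , vy , y-leaf , res = resolved-by-arm-leaf u≢v av (outside-adjacent-centre u∉S)
      in y , arm-leaves-inside av vy y-leaf , res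
    ... | no u-non-leaf | yes _ =
      let au = outside-arm u∉S u-non-leaf
          y , uy , y-leaf , res = resolved-by-arm-leaf (u≢v ∘ sym) au (outside-adjacent-centre v∉S)
      in y , arm-leaves-inside au uy y-leaf , StronglyResolves-sym H res
    ... | yes u-leaf | yes v-leaf = contradiction (one-leaf-outside u∉S v∉S u-leaf v-leaf) u≢v

    resolving-T : IsStrongMetricGenerator T S
    resolving-T = resolving T (proj₁ tree) λ u≢v av uc →
      let y , vy , y-leaf , res , _ = arm-leaf-resolves u≢v av uc in y , vy , y-leaf , res

    resolving-Tᶜ : IsStrongMetricGenerator Tᶜ S
    resolving-Tᶜ = resolving Tᶜ complement-connected λ u≢v av uc →
      let y , vy , y-leaf , _ , res = arm-leaf-resolves u≢v av uc in y , vy , y-leaf , res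

  leaf-survives-removal : ∀ {R : Subset n} {w y} → IsLeaf T w → w ∈ R → ¬ IsLeaf T y → w ∈ R - y
  leaf-survives-removal w-leaf w∈R y-non-leaf = x∈p∧x≢y⇒x∈p-y w∈R (λ { refl → y-non-leaf w-leaf })

  module _ {S : Subset n} (resolving-T : IsStrongMetricGenerator T S)
    (resolving-Tᶜ : IsStrongMetricGenerator Tᶜ S) where

    leaf-pair-hit : ∀ {u v} → IsLeaf T u → IsLeaf T v → u ≢ v → u ∈ S ⊎ v ∈ S
    leaf-pair-hit u-leaf v-leaf u≢v =
      generator-separates T resolving-T u≢v
        (pendants-unresolved T (leaf-pendant T u-leaf) (leaf-pendant T v-leaf) u≢v)

    edge-hit : ∀ {u v} → u ~ v → u ∈ S ⊎ v ∈ S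
    edge-hit uv = generator-separates Tᶜ resolving-Tᶜ (adj⇒≢ T uv)
      (nonadjacent-unresolved Tᶜ complement-near (adj⇒≢ T uv) (complement-nonadj T uv))

    other-leaves-inside : ∀ {x y} → IsLeaf T x → x ∉ S → ¬ IsLeaf T y → leaves T - x ⊆ S - y
    other-leaves-inside x-leaf x∉S y-non-leaf {w} w∈leaves-x
      with w-leaf ← ∈leaves⁻ T (x∈p-y⇒x∈p w∈leaves-x)
      with leaf-pair-hit w-leaf x-leaf (x∈p-y⇒x≢y w∈leaves-x)
    ... | inj₁ w∈S = leaf-survives-removal w-leaf w∈S y-non-leaf
    ... | inj₂ x∈S = contradiction x∈S x∉S

    missing-leaf-neighbour-inside : ∀ {x p} → x ∉ S → x ~ p → p ∈ S
    missing-leaf-neighbour-inside x∉S xp with edge-hit xp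
    ... | inj₁ x∈S = contradiction x∈S x∉S
    ... | inj₂ p∈S = p∈S

    centre-edge-hit : ∀ {s} → Arm s → ∃[ y ] (y ∈ S × ¬ IsLeaf T y × (y ≡ c ⊎ y ≡ s))
    centre-edge-hit {s} as with edge-hit (arm-adjacent-centre as)
    ... | inj₁ c∈S = c , c∈S , c-non-leaf , inj₁ refl
    ... | inj₂ s∈S = s , s∈S , proj₁ as , inj₂ refl

    leaves-lower-bound : ∣ leaves T ∣ ≤ ∣ S ∣
    leaves-lower-bound with ⊆-or-counterexample (leaves T) S
    ... | inj₁ leaves⊆S = p⊆q⇒∣p∣≤∣q∣ leaves⊆S
    ... | inj₂ (x , x∈leaves , x∉S) =
      let x-leaf = ∈leaves⁻ T x∈leaves
          p , xp = leaf-neighbour T x-leaf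
      in p-x⊆q-y⇒∣p∣≤∣q∣ x∈leaves (missing-leaf-neighbour-inside x∉S xp)
           (other-leaves-inside x-leaf x∉S (leaf-neighbour-non-leaf x-leaf xp))

    non-leaf-inside-avoiding : ∀ {p} → p ≢ c → ∃[ y ] (y ∈ S × ¬ IsLeaf T y × y ≢ p)
    non-leaf-inside-avoiding {p} p≢c with arm-other-than p
    ... | s , as , s≢p with centre-edge-hit as
    ... | y , y∈S , y-non-leaf , inj₁ refl = y , y∈S , y-non-leaf , p≢c ∘ sym
    ... | y , y∈S , y-non-leaf , inj₂ refl = y , y∈S , y-non-leaf , s≢p

    leaves-strict-lower-bound : ¬ IsSupport T c → ∣ leaves T ∣ < ∣ S ∣
    leaves-strict-lower-bound c-not-support with ⊆-or-counterexample (leaves T) S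
    ... | inj₁ leaves⊆S =
      let s , _ , as , _ = two-arms
          y , y∈S , y-non-leaf , _ = centre-edge-hit as
      in ≤-<-trans
           (p⊆q⇒∣p∣≤∣q∣ λ w∈leaves → leaf-survives-removal (∈leaves⁻ T w∈leaves) (leaves⊆S w∈leaves) y-non-leaf)
           (x∈p⇒∣p-x∣<∣p∣ y∈S)
    ... | inj₂ (x , x∈leaves , x∉S)
      with x-leaf ← ∈leaves⁻ T x∈leaves
      with leaf-neighbour T x-leaf
    ... | p , xp with non-leaf-inside-avoiding {p} (λ { refl → c-not-support (x , ~-sym xp , x-leaf) })
    ... | y , y∈S , y-non-leaf , y≢p =
      -- ∣leaves∣ = 1 + ∣leaves - x∣ ≤ 1 + ∣S - y - p∣ = ∣S - y∣ < ∣S∣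
      ≤-<-trans (p-x⊆q-y⇒∣p∣≤∣q∣ x∈leaves (x∈p∧x≢y⇒x∈p-y (missing-leaf-neighbour-inside x∉S xp) (y≢p ∘ sym))
                   λ w∈leaves-x → leaf-survives-removal (∈leaves⁻ T (x∈p-y⇒x∈p w∈leaves-x))
                                    (other-leaves-inside x-leaf x∉S y-non-leaf w∈leaves-x) (leaf-neighbour-non-leaf x-leaf xp))
                (x∈p⇒∣p-x∣<∣p∣ y∈S)

  with-support : IsSupport T c → SimStrongDim T Tᶜ (numLeaves T)
  with-support (x , cx , x-leaf) =
    (S , resolving-T outside-adjacent-centre one-leaf-outside arm-leaves-inside
       , resolving-Tᶜ outside-adjacent-centre one-leaf-outside arm-leaves-inside , size)
    , λ S′ gen gen′ → subst (_≤ ∣ S′ ∣) (sym (numLeaves≡∣leaves∣ T)) (leaves-lower-bound gen gen′)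
    where
    S : Subset n
    S = (leaves T - x) ∪ ⁅ c ⁆
    x∈leaves : x ∈ leaves T
    x∈leaves = ∈leaves⁺ T x-leaf
    outside≢c : ∀ {u} → u ∉ S → u ≢ c
    outside≢c u∉S refl = u∉S (x∈p∪q⁺ (inj₂ (x∈⁅x⁆ c)))
    leaf-outside⇒x : ∀ {u} → u ∉ S → IsLeaf T u → u ≡ x
    leaf-outside⇒x {u} u∉S u-leaf with u ≟ x
    ... | yes u≡x = u≡x
    ... | no u≢x = contradiction (x∈p∪q⁺ (inj₁ (x∈p∧x≢y⇒x∈p-y (∈leaves⁺ T u-leaf) u≢x))) u∉S
    outside-adjacent-centre : ∀ {u} → u ∉ S → u ~ c
    outside-adjacent-centre {u} u∉S with isLeaf? T u
    ... | yes u-leaf = subst (_~ c) (sym (leaf-outside⇒x u∉S u-leaf)) (~-sym cx)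
    ... | no u-non-leaf = non-leaf-adjacent-centre u-non-leaf (outside≢c u∉S)
    one-leaf-outside : ∀ {u v} → u ∉ S → v ∉ S → IsLeaf T u → IsLeaf T v → u ≡ v
    one-leaf-outside u∉S v∉S u-leaf v-leaf = trans (leaf-outside⇒x u∉S u-leaf) (sym (leaf-outside⇒x v∉S v-leaf))
    arm-leaves-inside : ∀ {v y} → Arm v → v ~ y → IsLeaf T y → y ∈ S
    arm-leaves-inside {v} {y} (_ , v≢c) vy y-leaf = x∈p∪q⁺ (inj₁ (x∈p∧x≢y⇒x∈p-y (∈leaves⁺ T y-leaf) y≢x))
      where
      y≢x : y ≢ x
      y≢x refl = v≢c (leaf-pendant T x-leaf (~-sym vy) (~-sym cx))
    size : ∣ S ∣ ≡ numLeaves T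
    size = begin
      ∣ (leaves T - x) ∪ ⁅ c ⁆ ∣  ≡⟨ ∣p∪⁅x⁆∣≡1+∣p∣ (c-non-leaf ∘ ∈leaves⁻ T ∘ x∈p-y⇒x∈p) ⟩
      suc ∣ leaves T - x ∣         ≡⟨ sym (∣p∣≡1+∣p-x∣ x∈leaves) ⟩
      ∣ leaves T ∣                 ≡⟨ sym (numLeaves≡∣leaves∣ T) ⟩
      numLeaves T                  ∎
      where open ≡-Reasoning

  without-support : ¬ IsSupport T c → SimStrongDim T Tᶜ (numLeaves T + 1)
  without-support c-not-support =
    (S , resolving-T outside-adjacent-centre one-leaf-outside arm-leaves-inside
       , resolving-Tᶜ outside-adjacent-centre one-leaf-outside arm-leaves-inside , size)
    , λ S′ gen gen′ → subst (_≤ ∣ S′ ∣) (sym size′) (leaves-strict-lower-bound gen gen′ c-not-support)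
    where
    S : Subset n
    S = leaves T ∪ ⁅ c ⁆
    size′ : numLeaves T + 1 ≡ suc ∣ leaves T ∣
    size′ = trans (+-comm (numLeaves T) 1) (cong suc (numLeaves≡∣leaves∣ T))
    outside-adjacent-centre : ∀ {u} → u ∉ S → u ~ c
    outside-adjacent-centre u∉S =
      non-leaf-adjacent-centre (u∉S ∘ x∈p∪q⁺ ∘ inj₁ ∘ ∈leaves⁺ T) (λ { refl → u∉S (x∈p∪q⁺ (inj₂ (x∈⁅x⁆ c))) })
    one-leaf-outside : ∀ {u v} → u ∉ S → v ∉ S → IsLeaf T u → IsLeaf T v → u ≡ v
    one-leaf-outside u∉S _ u-leaf _ = contradiction (x∈p∪q⁺ (inj₁ (∈leaves⁺ T u-leaf))) u∉S
    arm-leaves-inside : ∀ {v y} → Arm v → v ~ y → IsLeaf T y → y ∈ S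
    arm-leaves-inside _ _ y-leaf = x∈p∪q⁺ (inj₁ (∈leaves⁺ T y-leaf))
    size : ∣ S ∣ ≡ numLeaves T + 1
    size = trans (∣p∪⁅x⁆∣≡1+∣p∣ (c-non-leaf ∘ ∈leaves⁻ T)) (sym size′)

mainTheorem19 : ∀ (n : ℕ) (T : Graph n) → IsTree T → HasDiameter T 4 →
    (c : Fin n) → IsInnerCentral T c →
    (IsSupport T c → SimStrongDim T (complement T) (numLeaves T))
    × (¬ IsSupport T c → SimStrongDim T (complement T) (numLeaves T + 1))
mainTheorem19 n T tree diameter c central = with-support , without-support
  where open DiameterFour T tree diameter c central
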